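{- Let $S$ and $T$ be balanced bitstrings. Then the following are equivalent: (i) for all units of area $(x,y)\neq(x',y')$ that are both between $S$ and $T$, we have $x\neq x'$ and $y\neq y'$; (ii) $S$ and $T$ differ by defects. Moreover, if $S$ and $T$ differ by defects, then the number of defects equals the area between $S$ and $T$.
   Context: Two bitstrings are balanced if they have the same length and the same number of ones. A unit of area is a pair $(x,y)\in\mathbb{Z}^2$. $(x,y)$ is below a string $S$ if some prefix of $S$ (possibly empty) has at most $x$ zeros and at least $y+1$ ones; $(x,y)$ is above $S$ if some prefix of $S$ has at most $y$ ones and at least $x+1$ zeros. For balanced $S,T$, $(x,y)$ is between $S$ and $T$ if it is above one and below the other; the area between $S$ and $T$ is the (finite) number of units of area between them. Characters are indexed from $1$, $S[i]$ denoting the $i$-th character. For balanced $S,T$ of length $L$, a defect is an index $1\le i\le L-1$ such that the length-$(i-1)$ prefixes of $S$ and $T$ are balanced, $S[i]\neq T[i]$, $S[i]\neq S[i+1]$, and $S[i+1]\neq T[i+1]$. $S$ and $T$ differ by defects if they are balanced and for every index $1\le i\le L$ with $S[i]\neq T[i]$ there is a defect at index $i-1$ or at index $i$. -}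

module Defs where

open import Data.Bool using (Bool; true; false)
open import Data.Nat using (ℕ; zero; suc; _+_; _∸_; _≤_)
open import Data.Integer using (ℤ; +_; _≤_; _+_)
open import Data.List using (List; []; _∷_; length; take)
open import Data.Maybe using (Maybe; just; nothing)
open import Data.Product using (Σ; ∃; ∃-syntax; _×_; _,_; proj₁; proj₂)
open import Data.Sum using (_⊎_)
open import Relation.Binary.PropositionalEquality using (_≡_; _≢_)
open import Function.Bundles using (_⇔_)
open import Data.List.Membership.Propositional using (_∈_)
open import Data.List.Relation.Unary.Unique.Propositional using (Unique)

Bitstring : Set
Bitstring = List Bool

ones : Bitstring → ℕ
ones []           = 0
ones (true ∷ s)   = suc (ones s)
ones (false ∷ s)  = ones s

zeros : Bitstring → ℕ
zeros []          = 0
zeros (true ∷ s)  = zeros s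
zeros (false ∷ s) = suc (zeros s)

Balanced : Bitstring → Bitstring → Set
Balanced S T = length S ≡ length T × ones S ≡ ones T

-- 1-indexed character access: S ! i = just S[i] for 1 ≤ i ≤ length S.
_!_ : Bitstring → ℕ → Maybe Bool
[]      ! _           = nothing
(b ∷ s) ! zero        = nothing
(b ∷ s) ! suc zero    = just b
(b ∷ s) ! suc (suc i) = s ! suc i

Unit : Set
Unit = ℤ × ℤ

Below : Bitstring → Unit → Set
Below S (x , y) = ∃[ k ] (k Data.Nat.≤ length S
  × (+ zeros (take k S)) Data.Integer.≤ x
  × (y Data.Integer.+ + 1) Data.Integer.≤ (+ ones (take k S)))

Above : Bitstring → Unit → Set
Above S (x , y) = ∃[ k ] (k Data.Nat.≤ length S
  × (+ ones (take k S)) Data.Integer.≤ y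
  × (x Data.Integer.+ + 1) Data.Integer.≤ (+ zeros (take k S)))

Between : Bitstring → Bitstring → Unit → Set
Between S T u = (Above S u × Below T u) ⊎ (Above T u × Below S u)

Defect : Bitstring → Bitstring → ℕ → Set
Defect S T i =
  1 Data.Nat.≤ i × i Data.Nat.≤ length S ∸ 1
  × Balanced (take (i ∸ 1) S) (take (i ∸ 1) T)
  × S ! i ≢ T ! i
  × S ! i ≢ S ! (suc i)
  × S ! (suc i) ≢ T ! (suc i)

DifferByDefects : Bitstring → Bitstring → Set
DifferByDefects S T = Balanced S T
  × (∀ i → 1 Data.Nat.≤ i → i Data.Nat.≤ length S → S ! i ≢ T ! i
       → Defect S T (i ∸ 1) ⊎ Defect S T i)

HasCard : {A : Set} → (A → Set) → ℕ → Set
HasCard {A} P n = Σ (List A) λ xs → Unique xs × (∀ a → (a ∈ xs) ⇔ P a) × length xs ≡ n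

NoSharedCoord : Bitstring → Bitstring → Set
NoSharedCoord S T = ∀ (u v : Unit) → u ≢ v → Between S T u → Between S T v
  → proj₁ u ≢ proj₁ v × proj₂ u ≢ proj₂ v

-- Reading S and T letter by letter, a common first letter only shifts the
-- region between them by one column (letter 0) or one row (letter 1) and
-- shifts every defect by one index.  A differing first letter is compatible
-- with (i), and also with (ii), only if S and T start with a transposed pair
-- 01/10: otherwise two of the units (0,0), (1,0), (0,1) lie between them in a
-- common row or column, and index 1 is not a defect.  So both conditions say
-- that T arises from S by transposing disjoint adjacent pairs 01 ↔ 10, and
-- each transposition contributes exactly one defect (at its first index) and
-- one unit of area (at the corner it cuts off).
module Submission where

open import Defs
open import Data.Nat using (ℕ)
open import Data.Product using (Σ; _×_)
open import Function.Bundles using (_⇔_)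

open import Data.Bool using (true; false; not)
open import Data.Bool.Properties using (not-¬)
open import Data.Empty using (⊥; ⊥-elim)
open import Data.Integer using (+_; -[1+_]; +≤+)
open import Data.Integer.Properties using (+-injective)
open import Data.List using (List; []; _∷_; length; take; map)
open import Data.List.Membership.Propositional using (_∈_)
open import Data.List.Membership.Propositional.Properties using (∈-map⁺; ∈-map⁻)
open import Data.List.Properties using (length-map)
import Data.List.Relation.Unary.All as All
import Data.List.Relation.Unary.All.Properties as All
open import Data.List.Relation.Unary.Any using (here; there)
open import Data.List.Relation.Unary.Unique.Propositional using (Unique; []; _∷_)
import Data.List.Relation.Unary.Unique.Propositional.Properties as Unique
open import Data.Maybe using (just)
open import Data.Maybe.Properties using (just-injective)
open import Data.Nat as ℕ using (zero; suc; z≤n; s≤s; pred; _∸_)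
open import Data.Nat.Properties using (+-comm; suc-injective; ≤-pred; 0≢1+n; _≟_)
open import Data.Product as Product using (_,_; proj₁; proj₂; ∃-syntax; ∃₂)
open import Data.Sum as Sum using (_⊎_; inj₁; inj₂; [_,_])
open import Data.Unit using (⊤; tt)
open import Function using (_∘_; id)
open import Function.Bundles using (mk⇔; module Equivalence)
open import Function.Definitions using (Injective)
open import Relation.Binary.PropositionalEquality using (_≡_; _≢_; refl; cong; cong₂; subst; trans; ≢-sym)
open import Relation.Nullary using (¬_; contradiction)
open import Relation.Nullary.Decidable using (decidable-stable)

open Equivalence using (to; from)

-- The region between two strings, on ℕ²

Below⁺ : Bitstring → ℕ → ℕ → Set
Below⁺ []          m       n       = ⊥
Below⁺ (false ∷ S) zero    n       = ⊥
Below⁺ (false ∷ S) (suc m) n       = Below⁺ S m n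
Below⁺ (true ∷ S)  m       zero    = ⊤
Below⁺ (true ∷ S)  m       (suc n) = Below⁺ S m n

Above⁺ : Bitstring → ℕ → ℕ → Set
Above⁺ []          m       n       = ⊥
Above⁺ (true ∷ S)  m       zero    = ⊥
Above⁺ (true ∷ S)  m       (suc n) = Above⁺ S m n
Above⁺ (false ∷ S) zero    n       = ⊤
Above⁺ (false ∷ S) (suc m) n       = Above⁺ S m n

Between⁺ : Bitstring → Bitstring → ℕ → ℕ → Set
Between⁺ S T m n = (Above⁺ S m n × Below⁺ T m n) ⊎ (Above⁺ T m n × Below⁺ S m n)

prefix⇒Below⁺ : ∀ S k {m n} → zeros (take k S) ℕ.≤ m → suc n ℕ.≤ ones (take k S) → Below⁺ S m n
prefix⇒Below⁺ (false ∷ S) (suc k) {suc m} (s≤s p) q       = prefix⇒Below⁺ S k p q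
prefix⇒Below⁺ (true ∷ S)  (suc k) {n = zero}  p q         = tt
prefix⇒Below⁺ (true ∷ S)  (suc k) {n = suc n} p (s≤s q)   = prefix⇒Below⁺ S k p q

Below⁺⇒prefix : ∀ S {m n} → Below⁺ S m n
  → ∃[ k ] (k ℕ.≤ length S × zeros (take k S) ℕ.≤ m × suc n ℕ.≤ ones (take k S))
Below⁺⇒prefix (false ∷ S) {suc m} b =
  let k , k≤ , p , q = Below⁺⇒prefix S b in suc k , s≤s k≤ , s≤s p , q
Below⁺⇒prefix (true ∷ S) {n = zero} _ = 1 , s≤s z≤n , z≤n , s≤s z≤n
Below⁺⇒prefix (true ∷ S) {n = suc n} b =
  let k , k≤ , p , q = Below⁺⇒prefix S b in suc k , s≤s k≤ , p , s≤s q

prefix⇒Above⁺ : ∀ S k {m n} → ones (take k S) ℕ.≤ n → suc m ℕ.≤ zeros (take k S) → Above⁺ S m n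
prefix⇒Above⁺ (true ∷ S)  (suc k) {n = suc n} (s≤s p) q   = prefix⇒Above⁺ S k p q
prefix⇒Above⁺ (false ∷ S) (suc k) {zero}  p q             = tt
prefix⇒Above⁺ (false ∷ S) (suc k) {suc m} p (s≤s q)       = prefix⇒Above⁺ S k p q

Above⁺⇒prefix : ∀ S {m n} → Above⁺ S m n
  → ∃[ k ] (k ℕ.≤ length S × ones (take k S) ℕ.≤ n × suc m ℕ.≤ zeros (take k S))
Above⁺⇒prefix (true ∷ S) {n = suc n} a =
  let k , k≤ , p , q = Above⁺⇒prefix S a in suc k , s≤s k≤ , s≤s p , q
Above⁺⇒prefix (false ∷ S) {zero} _ = 1 , s≤s z≤n , z≤n , s≤s z≤n
Above⁺⇒prefix (false ∷ S) {suc m} a =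
  let k , k≤ , p , q = Above⁺⇒prefix S a in suc k , s≤s k≤ , p , s≤s q

Below⇔Below⁺ : ∀ S m n → Below S (+ m , + n) ⇔ Below⁺ S m n
Below⇔Below⁺ S m n = mk⇔
  (λ where (k , _ , +≤+ p , +≤+ q) → prefix⇒Below⁺ S k p (subst (ℕ._≤ ones (take k S)) (+-comm n 1) q))
  (λ b → let k , k≤ , p , q = Below⁺⇒prefix S b
         in k , k≤ , +≤+ p , +≤+ (subst (ℕ._≤ ones (take k S)) (+-comm 1 n) q))

Above⇔Above⁺ : ∀ S m n → Above S (+ m , + n) ⇔ Above⁺ S m n
Above⇔Above⁺ S m n = mk⇔
  (λ where (k , _ , +≤+ p , +≤+ q) → prefix⇒Above⁺ S k p (subst (ℕ._≤ zeros (take k S)) (+-comm m 1) q))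
  (λ a → let k , k≤ , p , q = Above⁺⇒prefix S a
         in k , k≤ , +≤+ p , +≤+ (subst (ℕ._≤ zeros (take k S)) (+-comm 1 m) q))

Between⇔Between⁺ : ∀ S T m n → Between S T (+ m , + n) ⇔ Between⁺ S T m n
Between⇔Between⁺ S T m n = mk⇔
  (Sum.map (Product.map (to (Above⇔Above⁺ S m n)) (to (Below⇔Below⁺ T m n)))
           (Product.map (to (Above⇔Above⁺ T m n)) (to (Below⇔Below⁺ S m n))))
  (Sum.map (Product.map (from (Above⇔Above⁺ S m n)) (from (Below⇔Below⁺ T m n)))
           (Product.map (from (Above⇔Above⁺ T m n)) (from (Below⇔Below⁺ S m n))))

Between⇒nonNegative : ∀ S T {u} → Between S T u → ∃₂ λ m n → u ≡ (+ m , + n)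
Between⇒nonNegative S T {+ m , + n} _ = m , n , refl
Between⇒nonNegative S T { -[1+ _ ] , _ } (inj₁ (_ , _ , _ , () , _))
Between⇒nonNegative S T { -[1+ _ ] , _ } (inj₂ (_ , _ , _ , () , _))
Between⇒nonNegative S T {+ _ , -[1+ _ ]} (inj₁ ((_ , _ , () , _) , _))
Between⇒nonNegative S T {+ _ , -[1+ _ ]} (inj₂ ((_ , _ , () , _) , _))

CoordInjective : (ℕ → ℕ → Set) → Set
CoordInjective P = ∀ {m n m′ n′} → P m n → P m′ n′ → (m ≡ m′ → n ≡ n′) × (n ≡ n′ → m ≡ m′)

NoSharedCoord⇔CoordInjective : ∀ S T → NoSharedCoord S T ⇔ CoordInjective (Between⁺ S T)
NoSharedCoord⇔CoordInjective S T = mk⇔ to′ from′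
  where
  to′ : NoSharedCoord S T → CoordInjective (Between⁺ S T)
  to′ nsc {m} {n} {m′} {n′} h h′ =
    (λ m≡m′ → decidable-stable (n ≟ n′) λ n≢n′ →
      proj₁ (shared (n≢n′ ∘ +-injective ∘ cong proj₂)) (cong +_ m≡m′)) ,
    (λ n≡n′ → decidable-stable (m ≟ m′) λ m≢m′ →
      proj₂ (shared (m≢m′ ∘ +-injective ∘ cong proj₁)) (cong +_ n≡n′))
    where
    shared : (+ m , + n) ≢ (+ m′ , + n′) → + m ≢ + m′ × + n ≢ + n′
    shared u≢v = nsc _ _ u≢v (from (Between⇔Between⁺ S T m n) h) (from (Between⇔Between⁺ S T m′ n′) h′)

  from′ : CoordInjective (Between⁺ S T) → NoSharedCoord S T
  from′ ci u v u≢v hu hv with Between⇒nonNegative S T hu | Between⇒nonNegative S T hv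
  ... | m , n , refl | m′ , n′ , refl =
    (λ x≡ → u≢v (cong₂ _,_ x≡ (cong +_ (proj₁ sameCoord (+-injective x≡))))) ,
    (λ y≡ → u≢v (cong₂ _,_ (cong +_ (proj₂ sameCoord (+-injective y≡))) y≡))
    where
    sameCoord : (m ≡ m′ → n ≡ n′) × (n ≡ n′ → m ≡ m′)
    sameCoord = ci (to (Between⇔Between⁺ S T m n) hu) (to (Between⇔Between⁺ S T m′ n′) hv)

coordInjective-reindex : ∀ {P Q : ℕ → ℕ → Set} {f g : ℕ → ℕ} → Injective _≡_ _≡_ f → Injective _≡_ _≡_ g
  → (∀ {m n} → Q m n → P (f m) (g n)) → CoordInjective P → CoordInjective Q
coordInjective-reindex f-inj g-inj embed ci q q′ =
  let sameˣ , sameʸ = ci (embed q) (embed q′)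
  in g-inj ∘ sameˣ ∘ cong _ , f-inj ∘ sameʸ ∘ cong _

coordInjective-sucˣ : ∀ {P : ℕ → ℕ → Set} → (∀ {n} → ¬ P 0 n)
  → CoordInjective (λ m → P (suc m)) → CoordInjective P
coordInjective-sucˣ ¬P₀ ci {zero}               p _ = ⊥-elim (¬P₀ p)
coordInjective-sucˣ ¬P₀ ci {suc _} {m′ = zero}  _ q = ⊥-elim (¬P₀ q)
coordInjective-sucˣ ¬P₀ ci {suc _} {m′ = suc _} p q =
  let sameˣ , sameʸ = ci p q in sameˣ ∘ suc-injective , cong suc ∘ sameʸ

coordInjective-sucʸ : ∀ {P : ℕ → ℕ → Set} → (∀ {m} → ¬ P m 0)
  → CoordInjective (λ m n → P m (suc n)) → CoordInjective P
coordInjective-sucʸ ¬P₀ ci {n = zero}               p _ = ⊥-elim (¬P₀ p)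
coordInjective-sucʸ ¬P₀ ci {n = suc _} {n′ = zero}  _ q = ⊥-elim (¬P₀ q)
coordInjective-sucʸ ¬P₀ ci {n = suc _} {n′ = suc _} p q =
  let sameˣ , sameʸ = ci p q in cong suc ∘ sameˣ , sameʸ ∘ suc-injective

data OriginOrShifted (P : ℕ → ℕ → Set) : ℕ → ℕ → Set where
  origin  : OriginOrShifted P 0 0
  shifted : ∀ {m n} → P m n → OriginOrShifted P (suc m) (suc n)

coordInjective-originOrShifted : ∀ {P} → CoordInjective P → CoordInjective (OriginOrShifted P)
coordInjective-originOrShifted ci origin      origin       = (λ _ → refl) , (λ _ → refl)
coordInjective-originOrShifted ci origin      (shifted _)  = (λ ()) , (λ ())
coordInjective-originOrShifted ci (shifted _) origin       = (λ ()) , (λ ())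
coordInjective-originOrShifted ci (shifted p) (shifted p′) =
  let sameˣ , sameʸ = ci p p′ in cong suc ∘ sameˣ ∘ suc-injective , cong suc ∘ sameʸ ∘ suc-injective

coordInjective-¬row : ∀ {P} → CoordInjective P → P 0 0 → P 1 0 → ⊥
coordInjective-¬row ci p p′ = 0≢1+n (proj₂ (ci p p′) refl)

coordInjective-¬column : ∀ {P} → CoordInjective P → P 0 0 → P 0 1 → ⊥
coordInjective-¬column ci p p′ = 0≢1+n (proj₁ (ci p p′) refl)

¬Between⁺-false₀ : ∀ S T {n} → ¬ Between⁺ (false ∷ S) (false ∷ T) 0 n
¬Between⁺-false₀ S T (inj₁ (_ , ()))
¬Between⁺-false₀ S T (inj₂ (_ , ()))

¬Between⁺-true₀ : ∀ S T {m} → ¬ Between⁺ (true ∷ S) (true ∷ T) m 0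
¬Between⁺-true₀ S T (inj₁ (() , _))
¬Between⁺-true₀ S T (inj₂ (() , _))

Between⁺-swap : ∀ b S T {m n}
  → Between⁺ (b ∷ not b ∷ S) (not b ∷ b ∷ T) m n ⇔ OriginOrShifted (Between⁺ S T) m n
Between⁺-swap b S T = mk⇔ (to′ b) (from′ b)
  where
  to′ : ∀ b {m n} → Between⁺ (b ∷ not b ∷ S) (not b ∷ b ∷ T) m n → OriginOrShifted (Between⁺ S T) m n
  to′ false {zero}  {zero}  _                = origin
  to′ false {zero}  {suc _} (inj₁ (_ , ()))
  to′ false {zero}  {suc _} (inj₂ (_ , ()))
  to′ false {suc _} {zero}  (inj₁ (() , _))
  to′ false {suc _} {zero}  (inj₂ (() , _))
  to′ false {suc _} {suc _} h                = shifted h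
  to′ true  {zero}  {zero}  _                = origin
  to′ true  {zero}  {suc _} (inj₁ (_ , ()))
  to′ true  {zero}  {suc _} (inj₂ (_ , ()))
  to′ true  {suc _} {zero}  (inj₁ (() , _))
  to′ true  {suc _} {zero}  (inj₂ (() , _))
  to′ true  {suc _} {suc _} h                = shifted h

  from′ : ∀ b {m n} → OriginOrShifted (Between⁺ S T) m n → Between⁺ (b ∷ not b ∷ S) (not b ∷ b ∷ T) m n
  from′ false origin      = inj₁ (tt , tt)
  from′ true  origin      = inj₂ (tt , tt)
  from′ false (shifted h) = h
  from′ true  (shifted h) = h

Balanced-keep : ∀ b S T → Balanced (b ∷ S) (b ∷ T) ⇔ Balanced S T
Balanced-keep false S T = mk⇔ (λ (l , o) → suc-injective l , o) (λ (l , o) → cong suc l , o)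
Balanced-keep true  S T = mk⇔ (λ (l , o) → suc-injective l , suc-injective o) (λ (l , o) → cong suc l , cong suc o)

Balanced-swap : ∀ b S T → Balanced (b ∷ not b ∷ S) (not b ∷ b ∷ T) ⇔ Balanced S T
Balanced-swap false S T = mk⇔ (λ (l , o) → suc-injective (suc-injective l) , suc-injective o)
                              (λ (l , o) → cong (suc ∘ suc) l , cong suc o)
Balanced-swap true  S T = mk⇔ (λ (l , o) → suc-injective (suc-injective l) , suc-injective o)
                              (λ (l , o) → cong (suc ∘ suc) l , cong suc o)

¬Balanced-[b]-[not-b] : ∀ b → ¬ Balanced (b ∷ []) (not b ∷ [])
¬Balanced-[b]-[not-b] false (_ , ())
¬Balanced-[b]-[not-b] true  (_ , ())

just≢just-not : ∀ b → just b ≢ just (not b)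
just≢just-not b = not-¬ refl ∘ just-injective

2+≤⇔1+≤pred : ∀ {j n} → suc (suc j) ℕ.≤ n ⇔ suc j ℕ.≤ pred n
2+≤⇔1+≤pred {n = zero}  = mk⇔ (λ ()) (λ ())
2+≤⇔1+≤pred {n = suc _} = mk⇔ ≤-pred s≤s

¬Defect₀ : ∀ S T → ¬ Defect S T 0
¬Defect₀ S T (() , _)

Defect-keep : ∀ b S T i → Defect (b ∷ S) (b ∷ T) (suc i) ⇔ Defect S T i
Defect-keep b S T i = mk⇔ (to′ i) (from′ i)
  where
  to′ : ∀ i → Defect (b ∷ S) (b ∷ T) (suc i) → Defect S T i
  to′ zero    (_ , _ , _ , S₁≢T₁ , _) = contradiction refl S₁≢T₁
  to′ (suc j) (_ , bound , bal , d) =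
    s≤s z≤n , to 2+≤⇔1+≤pred bound , to (Balanced-keep b (take j S) (take j T)) bal , d

  from′ : ∀ i → Defect S T i → Defect (b ∷ S) (b ∷ T) (suc i)
  from′ zero    = ⊥-elim ∘ ¬Defect₀ S T
  from′ (suc j) (_ , bound , bal , d) =
    s≤s z≤n , from 2+≤⇔1+≤pred bound , from (Balanced-keep b (take j S) (take j T)) bal , d

Defect-swap : ∀ b S T i → Defect (b ∷ not b ∷ S) (not b ∷ b ∷ T) (suc (suc i)) ⇔ Defect S T i
Defect-swap b S T i = mk⇔ (to′ i) (from′ i)
  where
  to′ : ∀ i → Defect (b ∷ not b ∷ S) (not b ∷ b ∷ T) (suc (suc i)) → Defect S T i
  to′ zero    (_ , _ , bal , _) = ⊥-elim (¬Balanced-[b]-[not-b] b bal)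
  to′ (suc j) (_ , s≤s bound , bal , d) =
    s≤s z≤n , to 2+≤⇔1+≤pred bound , to (Balanced-swap b (take j S) (take j T)) bal , d

  from′ : ∀ i → Defect S T i → Defect (b ∷ not b ∷ S) (not b ∷ b ∷ T) (suc (suc i))
  from′ zero    = ⊥-elim ∘ ¬Defect₀ S T
  from′ (suc j) (_ , bound , bal , d) =
    s≤s z≤n , s≤s (from 2+≤⇔1+≤pred bound) , from (Balanced-swap b (take j S) (take j T)) bal , d

Defect-swap₁ : ∀ b S T → Defect (b ∷ not b ∷ S) (not b ∷ b ∷ T) 1
Defect-swap₁ b S T = s≤s z≤n , s≤s z≤n , (refl , refl) , just≢just-not b , just≢just-not b , ≢-sym (just≢just-not b)

DefectsCover : Bitstring → Bitstring → Set
DefectsCover S T = ∀ i → 1 ℕ.≤ i → i ℕ.≤ length S → S ! i ≢ T ! i → Defect S T (i ∸ 1) ⊎ Defect S T i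

DefectsCover-keep : ∀ b S T → DefectsCover (b ∷ S) (b ∷ T) ⇔ DefectsCover S T
DefectsCover-keep b S T = mk⇔ to′ from′
  where
  to′ : DefectsCover (b ∷ S) (b ∷ T) → DefectsCover S T
  to′ cover (suc j) _ bound ≢ =
    Sum.map (to (Defect-keep b S T j)) (to (Defect-keep b S T (suc j)))
            (cover (suc (suc j)) (s≤s z≤n) (s≤s bound) ≢)

  from′ : DefectsCover S T → DefectsCover (b ∷ S) (b ∷ T)
  from′ cover 1 _ _ ≢ = contradiction refl ≢
  from′ cover (suc (suc j)) _ (s≤s bound) ≢ =
    Sum.map (from (Defect-keep b S T j)) (from (Defect-keep b S T (suc j))) (cover (suc j) (s≤s z≤n) bound ≢)

DefectsCover-swap : ∀ b S T → DefectsCover (b ∷ not b ∷ S) (not b ∷ b ∷ T) ⇔ DefectsCover S T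
DefectsCover-swap b S T = mk⇔ to′ from′
  where
  to′ : DefectsCover (b ∷ not b ∷ S) (not b ∷ b ∷ T) → DefectsCover S T
  to′ cover (suc j) _ bound ≢ =
    Sum.map (to (Defect-swap b S T j)) (to (Defect-swap b S T (suc j)))
            (cover (suc (suc (suc j))) (s≤s z≤n) (s≤s (s≤s bound)) ≢)

  from′ : DefectsCover S T → DefectsCover (b ∷ not b ∷ S) (not b ∷ b ∷ T)
  from′ cover 1 _ _ _ = inj₂ (Defect-swap₁ b S T)
  from′ cover 2 _ _ _ = inj₁ (Defect-swap₁ b S T)
  from′ cover (suc (suc (suc j))) _ (s≤s (s≤s bound)) ≢ =
    Sum.map (from (Defect-swap b S T j)) (from (Defect-swap b S T (suc j))) (cover (suc j) (s≤s z≤n) bound ≢)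

DefectsCover⇒Defect₁ : ∀ {b c} S T → just b ≢ just c → DefectsCover (b ∷ S) (c ∷ T) → Defect (b ∷ S) (c ∷ T) 1
DefectsCover⇒Defect₁ {b} {c} S T b≢c cover =
  [ ⊥-elim ∘ ¬Defect₀ (b ∷ S) (c ∷ T) , id ] (cover 1 (s≤s z≤n) (s≤s z≤n) b≢c)

-- Strings that differ by disjoint adjacent transpositions

data AdjacentSwaps : Bitstring → Bitstring → Set where
  []   : AdjacentSwaps [] []
  keep : ∀ b {S T} → AdjacentSwaps S T → AdjacentSwaps (b ∷ S) (b ∷ T)
  swap : ∀ b {S T} → AdjacentSwaps S T → AdjacentSwaps (b ∷ not b ∷ S) (not b ∷ b ∷ T)

swapCount : ∀ {S T} → AdjacentSwaps S T → ℕ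
swapCount []         = 0
swapCount (keep _ d) = swapCount d
swapCount (swap _ d) = suc (swapCount d)

AdjacentSwaps⇒DefectsCover : ∀ {S T} → AdjacentSwaps S T → DefectsCover S T
AdjacentSwaps⇒DefectsCover []         (suc _) _ ()
AdjacentSwaps⇒DefectsCover (keep b {S} {T} d) = from (DefectsCover-keep b S T) (AdjacentSwaps⇒DefectsCover d)
AdjacentSwaps⇒DefectsCover (swap b {S} {T} d) = from (DefectsCover-swap b S T) (AdjacentSwaps⇒DefectsCover d)

AdjacentSwaps⇒CoordInjective : ∀ {S T} → AdjacentSwaps S T → CoordInjective (Between⁺ S T)
AdjacentSwaps⇒CoordInjective []                     (inj₁ (() , _)) _
AdjacentSwaps⇒CoordInjective []                     (inj₂ (() , _)) _
AdjacentSwaps⇒CoordInjective (keep false {S} {T} d) =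
  coordInjective-sucˣ {Between⁺ (false ∷ S) (false ∷ T)} (λ {n} → ¬Between⁺-false₀ S T {n})
    (AdjacentSwaps⇒CoordInjective d)
AdjacentSwaps⇒CoordInjective (keep true {S} {T} d)  =
  coordInjective-sucʸ {Between⁺ (true ∷ S) (true ∷ T)} (λ {m} → ¬Between⁺-true₀ S T {m})
    (AdjacentSwaps⇒CoordInjective d)
AdjacentSwaps⇒CoordInjective (swap b d) h h′ =
  coordInjective-originOrShifted (AdjacentSwaps⇒CoordInjective d)
    (to (Between⁺-swap b _ _) h) (to (Between⁺-swap b _ _) h′)

-- The ways two balanced strings can begin; repeat and clash are excluded by both (i) and (ii).
data Heads : Bitstring → Bitstring → Set where
  []     : Heads [] []
  keep   : ∀ b {S T} → Balanced S T → Heads (b ∷ S) (b ∷ T)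
  swap   : ∀ b {S T} → Balanced S T → Heads (b ∷ not b ∷ S) (not b ∷ b ∷ T)
  repeat : ∀ b {S T} → Heads (b ∷ b ∷ S) (not b ∷ T)
  clash  : ∀ b {S T} → Heads (b ∷ not b ∷ S) (not b ∷ not b ∷ T)

heads : ∀ S T → Balanced S T → Heads S T
heads []                  []                  _     = []
heads []                  (_ ∷ _)             (() , _)
heads (_ ∷ _)             []                  (() , _)
heads (false ∷ S)         (false ∷ T)         bal   = keep false (to (Balanced-keep false S T) bal)
heads (true ∷ S)          (true ∷ T)          bal   = keep true (to (Balanced-keep true S T) bal)
heads (false ∷ [])        (true ∷ T)          (_ , ())
heads (false ∷ false ∷ S) (true ∷ T)          _     = repeat false
heads (false ∷ true ∷ S)  (true ∷ [])         (() , _)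
heads (false ∷ true ∷ S)  (true ∷ false ∷ T)  bal   = swap false (to (Balanced-swap false S T) bal)
heads (false ∷ true ∷ S)  (true ∷ true ∷ T)   _     = clash false
heads (true ∷ S)          (false ∷ [])        (_ , ())
heads (true ∷ true ∷ S)   (false ∷ T)         _     = repeat true
heads (true ∷ [])         (false ∷ _ ∷ _)     (() , _)
heads (true ∷ false ∷ S)  (false ∷ true ∷ T)  bal   = swap true (to (Balanced-swap true S T) bal)
heads (true ∷ false ∷ S)  (false ∷ false ∷ T) _     = clash true

DefectsCover⇒AdjacentSwaps : ∀ S T → Balanced S T → DefectsCover S T → AdjacentSwaps S T
DefectsCover⇒AdjacentSwaps S T bal cover with heads S T bal
... | [] = []
... | keep b {S′} {T′} bal′ =
  keep b (DefectsCover⇒AdjacentSwaps S′ T′ bal′ (to (DefectsCover-keep b S′ T′) cover))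
... | swap b {S′} {T′} bal′ =
  swap b (DefectsCover⇒AdjacentSwaps S′ T′ bal′ (to (DefectsCover-swap b S′ T′) cover))
... | repeat b =
  let (_ , _ , _ , _ , S₁≢S₂ , _) = DefectsCover⇒Defect₁ _ _ (just≢just-not b) cover in ⊥-elim (S₁≢S₂ refl)
... | clash b =
  let (_ , _ , _ , _ , _ , S₂≢T₂) = DefectsCover⇒Defect₁ _ _ (just≢just-not b) cover in ⊥-elim (S₂≢T₂ refl)

CoordInjective⇒AdjacentSwaps : ∀ S T → Balanced S T → CoordInjective (Between⁺ S T) → AdjacentSwaps S T
CoordInjective⇒AdjacentSwaps S T bal ci with heads S T bal
... | [] = []
... | keep false bal′ =
  keep false (CoordInjective⇒AdjacentSwaps _ _ bal′ (coordInjective-reindex suc-injective id id ci))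
... | keep true bal′ =
  keep true (CoordInjective⇒AdjacentSwaps _ _ bal′ (coordInjective-reindex id suc-injective id ci))
... | swap b bal′ =
  swap b (CoordInjective⇒AdjacentSwaps _ _ bal′
    (coordInjective-reindex suc-injective suc-injective (from (Between⁺-swap b _ _) ∘ shifted) ci))
... | repeat false    = ⊥-elim (coordInjective-¬row ci (inj₁ (tt , tt)) (inj₁ (tt , tt)))
... | repeat true     = ⊥-elim (coordInjective-¬column ci (inj₂ (tt , tt)) (inj₂ (tt , tt)))
... | clash false     = ⊥-elim (coordInjective-¬column ci (inj₁ (tt , tt)) (inj₁ (tt , tt)))
... | clash true      = ⊥-elim (coordInjective-¬row ci (inj₂ (tt , tt)) (inj₂ (tt , tt)))

-- Counting defects and units of area

units : ∀ {S T} → AdjacentSwaps S T → List (ℕ × ℕ)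
units []             = []
units (keep false d) = map (Product.map₁ suc) (units d)
units (keep true d)  = map (Product.map₂ suc) (units d)
units (swap _ d)     = (0 , 0) ∷ map (Product.map suc suc) (units d)

units-sound : ∀ {S T} (d : AdjacentSwaps S T) {m n} → (m , n) ∈ units d → Between⁺ S T m n
units-sound (keep false d) p with ∈-map⁻ _ p
... | _ , q , refl = units-sound d q
units-sound (keep true d)  p with ∈-map⁻ _ p
... | _ , q , refl = units-sound d q
units-sound (swap b {S} {T} d) (here refl) = from (Between⁺-swap b S T) origin
units-sound (swap b {S} {T} d) (there p) with ∈-map⁻ _ p
... | _ , q , refl = from (Between⁺-swap b S T) (shifted (units-sound d q))

units-complete : ∀ {S T} (d : AdjacentSwaps S T) {m n} → Between⁺ S T m n → (m , n) ∈ units d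
units-complete []                     (inj₁ (() , _))
units-complete []                     (inj₂ (() , _))
units-complete (keep false {S} {T} d) {zero} {n} h = ⊥-elim (¬Between⁺-false₀ S T {n} h)
units-complete (keep false d)         {suc _} h = ∈-map⁺ _ (units-complete d h)
units-complete (keep true {S} {T} d)  {m} {zero} h = ⊥-elim (¬Between⁺-true₀ S T {m} h)
units-complete (keep true d)          {n = suc _} h = ∈-map⁺ _ (units-complete d h)
units-complete (swap b {S} {T} d) h with to (Between⁺-swap b S T) h
... | origin     = here refl
... | shifted h′ = there (∈-map⁺ _ (units-complete d h′))

units-unique : ∀ {S T} (d : AdjacentSwaps S T) → Unique (units d)
units-unique []             = []
units-unique (keep false d) = Unique.map⁺ (λ { {_ , _} {_ , _} refl → refl }) (units-unique d)
units-unique (keep true d)  = Unique.map⁺ (λ { {_ , _} {_ , _} refl → refl }) (units-unique d)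
units-unique (swap _ d)     =
  All.map⁺ (All.universal (λ _ ()) (units d)) ∷
  Unique.map⁺ (λ { {_ , _} {_ , _} refl → refl }) (units-unique d)

length-units : ∀ {S T} (d : AdjacentSwaps S T) → length (units d) ≡ swapCount d
length-units []             = refl
length-units (keep false d) = trans (length-map _ (units d)) (length-units d)
length-units (keep true d)  = trans (length-map _ (units d)) (length-units d)
length-units (swap _ d)     = cong suc (trans (length-map _ (units d)) (length-units d))

defects : ∀ {S T} → AdjacentSwaps S T → List ℕ
defects []         = []
defects (keep _ d) = map suc (defects d)
defects (swap _ d) = 1 ∷ map (2 ℕ.+_) (defects d)

defects-sound : ∀ {S T} (d : AdjacentSwaps S T) {i} → i ∈ defects d → Defect S T i
defects-sound (keep b {S} {T} d) p with ∈-map⁻ suc p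
... | j , q , refl = from (Defect-keep b S T j) (defects-sound d q)
defects-sound (swap b {S} {T} d) (here refl) = Defect-swap₁ b S T
defects-sound (swap b {S} {T} d) (there p) with ∈-map⁻ (2 ℕ.+_) p
... | j , q , refl = from (Defect-swap b S T j) (defects-sound d q)

defects-complete : ∀ {S T} (d : AdjacentSwaps S T) {i} → Defect S T i → i ∈ defects d
defects-complete []                 {suc _} (_ , () , _)
defects-complete {S} {T} d          {zero}  x = ⊥-elim (¬Defect₀ S T x)
defects-complete (keep b {S} {T} d) {suc j} x = ∈-map⁺ suc (defects-complete d (to (Defect-keep b S T j) x))
defects-complete (swap b d)         {1}     x = here refl
defects-complete (swap b {S} {T} d) {suc (suc j)} x =
  there (∈-map⁺ (2 ℕ.+_) (defects-complete d (to (Defect-swap b S T j) x)))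

defects-unique : ∀ {S T} (d : AdjacentSwaps S T) → Unique (defects d)
defects-unique []         = []
defects-unique (keep _ d) = Unique.map⁺ suc-injective (defects-unique d)
defects-unique (swap _ d) =
  All.map⁺ (All.universal (λ _ ()) (defects d)) ∷
  Unique.map⁺ (suc-injective ∘ suc-injective) (defects-unique d)

length-defects : ∀ {S T} (d : AdjacentSwaps S T) → length (defects d) ≡ swapCount d
length-defects []         = refl
length-defects (keep _ d) = trans (length-map suc (defects d)) (length-defects d)
length-defects (swap _ d) = cong suc (trans (length-map (2 ℕ.+_) (defects d)) (length-defects d))

Defect-hasCard : ∀ {S T} (d : AdjacentSwaps S T) → HasCard (Defect S T) (swapCount d)
Defect-hasCard d =
  defects d , defects-unique d , (λ _ → mk⇔ (defects-sound d) (defects-complete d)) , length-defects d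

Between-hasCard : ∀ {S T} (d : AdjacentSwaps S T) → HasCard (Between S T) (swapCount d)
Between-hasCard {S} {T} d =
  map toUnit (units d) ,
  Unique.map⁺ (λ { {_ , _} {_ , _} refl → refl }) (units-unique d) ,
  (λ u → mk⇔ (sound u) (complete u)) ,
  trans (length-map toUnit (units d)) (length-units d)
  where
  toUnit : ℕ × ℕ → Unit
  toUnit = Product.map +_ +_

  sound : ∀ u → u ∈ map toUnit (units d) → Between S T u
  sound u p with ∈-map⁻ toUnit p
  ... | (m , n) , q , refl = from (Between⇔Between⁺ S T m n) (units-sound d q)

  complete : ∀ u → Between S T u → u ∈ map toUnit (units d)
  complete u h with Between⇒nonNegative S T h
  ... | m , n , refl = ∈-map⁺ toUnit (units-complete d (to (Between⇔Between⁺ S T m n) h))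

lemma7 : (S T : Bitstring) → Balanced S T
    → (NoSharedCoord S T ⇔ DifferByDefects S T)
      × (DifferByDefects S T → Σ ℕ (λ n → HasCard (Defect S T) n × HasCard (Between S T) n))
lemma7 S T bal = mk⇔ (i⇒ii ∘ to noShared⇔) (from noShared⇔ ∘ ii⇒i) , count
  where
  noShared⇔ : NoSharedCoord S T ⇔ CoordInjective (Between⁺ S T)
  noShared⇔ = NoSharedCoord⇔CoordInjective S T

  i⇒ii : CoordInjective (Between⁺ S T) → DifferByDefects S T
  i⇒ii ci = bal , AdjacentSwaps⇒DefectsCover (CoordInjective⇒AdjacentSwaps S T bal ci)

  ii⇒i : DifferByDefects S T → CoordInjective (Between⁺ S T)
  ii⇒i (_ , cover) = AdjacentSwaps⇒CoordInjective (DefectsCover⇒AdjacentSwaps S T bal cover)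

  count : DifferByDefects S T → Σ ℕ (λ n → HasCard (Defect S T) n × HasCard (Between S T) n)
  count (_ , cover) = swapCount d , Defect-hasCard d , Between-hasCard d
    where
    d : AdjacentSwaps S T
    d = DefectsCover⇒AdjacentSwaps S T bal cover
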